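{- Let $x,y,x_1,x_2,y_{11},y_{12},y_{21},y_{22}\in\mathbb{F}_{q^2}$ with $y\ne y_{ij}$ for $i,j\in\{1,2\}$, and suppose the six points $(0,1,0)$, $P=(x,y,1)$ and $P_{ij}=(x_i,y_{ij},1)$ ($i,j\in\{1,2\}$) of $\mathcal{NP}$ form an O'Nan configuration, i.e. they are distinct and are the pairwise intersection points of four distinct lines of $\mathcal{NP}$. Suppose $\mathrm{Tr}(y_{11})=\mathrm{Tr}(y_{12})$. Then $\frac{x-x_2}{x-x_1}\in\mathbb{F}_q$ if and only if $\mathrm{Tr}(y_{21})=\mathrm{Tr}(y_{22})$.
   Context: Let $p$ be an odd prime, $q=p^e$. $\mathrm{Tr}(z)=z^q+z$ is the trace from $\mathbb{F}_{q^2}$ to $\mathbb{F}_q$. The regular nearfield $\mathcal N(2,q)$ has underlying set $\mathbb{F}_{q^2}$, field addition, and multiplication $x\star y=xy$ if $y$ is a nonzero square of $\mathbb{F}_{q^2}$, $x\star y=x^qy$ if $y$ is a nonsquare, $x\star0=0$. The plane $\mathcal{NP}$ has points $(x,y,1)$ ($x,y\in\mathbb{F}_{q^2}$), $(1,y,0)$, $(0,1,0)$; lines $[s,1,t]$, $[1,0,t]$ ($s,t\in\mathbb{F}_{q^2}$), $[0,0,1]$; $(x,y,z)$ lies on $[s,u,t]$ iff $x\star s+y\star u+z\star t=0$. -}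

module Defs where

open import Data.Nat using (ℕ; zero; suc)
open import Data.Fin using (Fin)
import Data.Fin as Fin
open import Data.Fin.Properties using (any?)
open import Data.Product using (Σ; _×_; _,_; ∃)
open import Function.Bundles using (_↔_; module Inverse)
open import Relation.Nullary using (¬_; Dec; yes; no)
open import Relation.Binary.PropositionalEquality using (_≡_; _≢_; subst)
open import Algebra.Structures using (IsCommutativeRing)

-- A finite field: commutative ring (with propositional equality) with
-- decidable equality, 0 ≠ 1, a total inverse (convention 0⁻¹ = 0),
-- and an explicit enumeration (bijection Fin card ↔ Carrier).
record FiniteField : Set₁ where
  infixl 6 _+_ _-_
  infixl 7 _*_
  field
    Carrier : Set
    _+_ _*_ : Carrier → Carrier → Carrier
    -_      : Carrier → Carrier
    _⁻¹     : Carrier → Carrier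
    0# 1#   : Carrier
    isCommutativeRing : IsCommutativeRing _≡_ _+_ _*_ -_ 0# 1#
    0≢1     : 0# ≢ 1#
    inverseʳ : ∀ x → x ≢ 0# → x * (x ⁻¹) ≡ 1#
    0⁻¹≡0   : 0# ⁻¹ ≡ 0#
    _≟_     : (x y : Carrier) → Dec (x ≡ y)
    card    : ℕ
    enum    : Fin card ↔ Carrier

  _-_ : Carrier → Carrier → Carrier
  x - y = x + (- y)

  _^ᶠ_ : Carrier → ℕ → Carrier
  x ^ᶠ zero  = 1#
  x ^ᶠ suc n = x * (x ^ᶠ n)

  IsSquare : Carrier → Set
  IsSquare y = ∃ λ w → w * w ≡ y

  isSquare? : (y : Carrier) → Dec (IsSquare y)
  isSquare? y with any? (λ i → (Inverse.to enum i * Inverse.to enum i) ≟ y)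
  ... | yes (i , e) = yes (Inverse.to enum i , e)
  ... | no ¬e = no λ { (w , e) → ¬e (Inverse.from enum w ,
         subst (λ v → v * v ≡ y) (sym' (Inverse.strictlyInverseˡ enum w)) e) }
    where
    sym' : ∀ {a b : Carrier} → a ≡ b → b ≡ a
    sym' Relation.Binary.PropositionalEquality.refl = Relation.Binary.PropositionalEquality.refl

module Plane (F : FiniteField) (q : ℕ) where
  open FiniteField F

  Tr : Carrier → Carrier
  Tr z = z ^ᶠ q + z

  InFq : Carrier → Set
  InFq z = z ^ᶠ q ≡ z

  -- nearfield multiplication of N(2,q)
  infixl 7 _⋆_
  _⋆_ : Carrier → Carrier → Carrier
  x ⋆ y with y ≟ 0#
  ... | yes _ = 0#
  ... | no _ with isSquare? y
  ...   | yes _ = x * y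
  ...   | no _  = (x ^ᶠ q) * y

  data Point : Set where
    aff  : Carrier → Carrier → Point
    dir  : Carrier → Point
    vinf : Point

  data Line : Set where
    nonvert : Carrier → Carrier → Line
    vert    : Carrier → Line
    linf    : Line

  record Triple : Set where
    constructor ⟨_,_,_⟩
    field c₁ c₂ c₃ : Carrier

  ptCoords : Point → Triple
  ptCoords (aff x y) = ⟨ x , y , 1# ⟩
  ptCoords (dir y)   = ⟨ 1# , y , 0# ⟩
  ptCoords vinf      = ⟨ 0# , 1# , 0# ⟩

  lnCoords : Line → Triple
  lnCoords (nonvert s t) = ⟨ s , 1# , t ⟩
  lnCoords (vert t)      = ⟨ 1# , 0# , t ⟩
  lnCoords linf          = ⟨ 0# , 0# , 1# ⟩

  _I_ : Point → Line → Set
  P I L with ptCoords P | lnCoords L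
  ... | ⟨ x , y , z ⟩ | ⟨ s , u , t ⟩ = x ⋆ s + y ⋆ u + z ⋆ t ≡ 0#

  ONan : (Fin 6 → Point) → Set
  ONan pts =
    (∀ i j → pts i ≡ pts j → i ≡ j) ×
    Σ (Fin 4 → Line) λ L →
      (∀ a b → L a ≡ L b → a ≡ b) ×
      (∀ a b → a ≢ b → ∃ λ k → (pts k I L a) × (pts k I L b)) ×
      (∀ k → ∃ λ a → ∃ λ b → a ≢ b × (pts k I L a) × (pts k I L b))

  sixPoints : (x y x₁ x₂ y₁₁ y₁₂ y₂₁ y₂₂ : Carrier) → Fin 6 → Point
  sixPoints x y x₁ x₂ y₁₁ y₁₂ y₂₁ y₂₂ Fin.zero = vinf
  sixPoints x y x₁ x₂ y₁₁ y₁₂ y₂₁ y₂₂ (Fin.suc Fin.zero) = aff x y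
  sixPoints x y x₁ x₂ y₁₁ y₁₂ y₂₁ y₂₂ (Fin.suc (Fin.suc Fin.zero)) = aff x₁ y₁₁
  sixPoints x y x₁ x₂ y₁₁ y₁₂ y₂₁ y₂₂ (Fin.suc (Fin.suc (Fin.suc Fin.zero))) = aff x₁ y₁₂
  sixPoints x y x₁ x₂ y₁₁ y₁₂ y₂₁ y₂₂ (Fin.suc (Fin.suc (Fin.suc (Fin.suc Fin.zero)))) = aff x₂ y₂₁
  sixPoints x y x₁ x₂ y₁₁ y₁₂ y₂₁ y₂₂ (Fin.suc (Fin.suc (Fin.suc (Fin.suc (Fin.suc Fin.zero))))) = aff x₂ y₂₂

{-# OPTIONS --safe #-}
module Submission where

-- Two of the four lines pass through V = (0,1,0), hence are vertical, and carry P₁₁, P₁₂ and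
-- P₂₁, P₂₂; the other two, [s,1,t] and [s',1,t'], meet at P and each contain one point of each
-- pair, say Pᵢ₁ on the first. Along [s,1,t] we have yᵢ₁ − y = (x − xᵢ) ⋆ s, and
-- Tr (u ⋆ s) = Tr (u σ(s)) where σ(s) is s or s^q according as s is a square or not. Hence
-- Tr yᵢ₁ − Tr yᵢ₂ = Tr ((x − xᵢ) c) with c = σ(s) − σ(s') ≠ 0. The hypothesis makes
-- z = (x − x₁) c a nonzero element of trace 0, and for such z, Tr (r z) = (r − r^q) z, which
-- vanishes iff r ∈ F_q; take r = (x − x₂)/(x − x₁). The field facts used, that x ↦ x^q is
-- additive and involutive, come from the binomial theorem in characteristic p and from
-- x^(q²) = x.

open import Defs
open import Data.Nat using (ℕ; _^_; _≤_)
open import Data.Nat.Primality using (Prime)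
open import Data.Product using (_×_)
open import Function.Bundles using (_⇔_)
open import Relation.Binary.PropositionalEquality using (_≡_; _≢_)

open import Level using (0ℓ)
open import Data.Nat as ℕ using (zero; suc; _<_; _∸_; _!; z<s; s<s)
import Data.Nat.Properties as ℕ
open import Data.Nat.Combinatorics using (nCk≡n!/k![n-k]!; k![n∸k]!∣n!; nCn≡1) renaming (_C_ to _choose_)
open import Data.Nat.Divisibility using (_∣_; _∤_; divides; ∣⇒≤; ∣1⇒≡1; m∣m*n)
open import Data.Nat.DivMod using (m/n*n≡m)
open import Data.Nat.Primality using (euclidsLemma; prime⇒nonZero; prime⇒nonTrivial; ¬prime[0])
open import Data.Fin as Fin using (Fin; zero; suc; toℕ; fromℕ; inject₁; punchIn; punchOut)
open import Data.Fin.Patterns using (0F; 1F; 2F; 3F; 4F)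
open import Data.Fin.Properties
  using (toℕ-fromℕ; toℕ-inject₁; toℕ<n; punchInᵢ≢i; punchIn-injective; punchIn-punchOut; suc-injective)
open import Data.Sum using (_⊎_; inj₁; inj₂)
open import Data.Product using (∃; _,_; proj₁; proj₂)
open import Data.Empty using (⊥; ⊥-elim)
open import Relation.Nullary using (¬_; Dec; yes; no)
open import Relation.Binary.PropositionalEquality using (refl; sym; trans; cong; cong₂; subst; module ≡-Reasoning)
open import Function.Base using (_∘_)
open import Function.Bundles using (_↔_; mk↔ₛ′; Inverse; mk⇔; Equivalence)
open import Function.Properties.Inverse using (↔-trans; ↔-sym)
open import Function.Properties.Equivalence using () renaming (trans to ⇔-trans)
open import Algebra.Bundles using (CommutativeRing; CommutativeMonoid)
import Algebra.Properties.Ring as RingProperties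
import Algebra.Properties.CommutativeSemigroup as CommutativeSemigroupProperties
import Algebra.Properties.CommutativeMonoid.Sum as Sum
import Algebra.Properties.Semiring.Mult as Mult
import Algebra.Properties.Semiring.Exp as Exp
import Algebra.Properties.CommutativeSemiring.Exp as CommutativeExp
import Algebra.Properties.CommutativeSemiring.Binomial as Binomial

prime∤! : ∀ {p} → Prime p → ∀ {m} → m < p → p ∤ m !
prime∤! p-prime {zero} _ p∣1 = ℕ.nonTrivial⇒≢1 {{prime⇒nonTrivial p-prime}} (∣1⇒≡1 p∣1)
prime∤! p-prime {suc m} m<p p∣m! with euclidsLemma (suc m) (m !) p-prime p∣m!
... | inj₁ p∣1+m = ℕ.<⇒≱ m<p (∣⇒≤ p∣1+m)
... | inj₂ p∣m!  = prime∤! p-prime (ℕ.<-trans (ℕ.n<1+n m) m<p) p∣m!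

n∣n! : ∀ n → .{{ℕ.NonZero n}} → n ∣ n !
n∣n! (suc n) = m∣m*n (n !)

prime∣choose : ∀ {p} → Prime p → ∀ {k} → 0 < k → k < p → p ∣ p choose k
prime∣choose {p} p-prime {k} 0<k k<p
  with euclidsLemma (p choose k) (k ! ℕ.* (p ∸ k) !) p-prime
         (subst (p ∣_) (sym C*k![p∸k]!≡p!) (n∣n! p))
  where
  instance _ = prime⇒nonZero p-prime
           _ = k ℕ.!* (p ∸ k) !≢0
  C*k![p∸k]!≡p! : (p choose k) ℕ.* (k ! ℕ.* (p ∸ k) !) ≡ p !
  C*k![p∸k]!≡p! = trans (cong (ℕ._* (k ! ℕ.* (p ∸ k) !)) (nCk≡n!/k![n-k]! (ℕ.<⇒≤ k<p)))
                        (m/n*n≡m (k![n∸k]!∣n! (ℕ.<⇒≤ k<p)))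
... | inj₁ p∣choose = p∣choose
... | inj₂ p∣k![p∸k]! with euclidsLemma (k !) ((p ∸ k) !) p-prime p∣k![p∸k]!
... | inj₁ p∣k! = ⊥-elim (prime∤! p-prime k<p p∣k!)
... | inj₂ p∣[p∸k]! = ⊥-elim (prime∤! p-prime (ℕ.∸-monoʳ-< 0<k (ℕ.<⇒≤ k<p)) p∣[p∸k]!)

module _ {n} {a b : Fin (suc (suc n))} (a≢b : a ≢ b) where
  private
    b' : Fin (suc n)
    b' = punchOut a≢b

  others : Fin n → Fin (suc (suc n))
  others i = punchIn a (punchIn b' i)

  others-injective : ∀ {i j} → others i ≡ others j → i ≡ j
  others-injective {i} {j} eq = punchIn-injective b' i j (punchIn-injective a _ _ eq)

  others-surjective : ∀ e → e ≢ a → e ≢ b → ∃ λ i → e ≡ others i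
  others-surjective e e≢a e≢b = punchOut e'≢b' , (begin
    e                       ≡⟨ punchIn-punchOut a≢e ⟨
    punchIn a e'            ≡⟨ cong (punchIn a) (punchIn-punchOut e'≢b') ⟨
    others (punchOut e'≢b') ∎)
    where
    open ≡-Reasoning
    a≢e = e≢a ∘ sym
    e' = punchOut a≢e
    e'≢b' : b' ≢ e'
    e'≢b' b'≡e' = e≢b (begin
      e              ≡⟨ punchIn-punchOut a≢e ⟨
      punchIn a e'   ≡⟨ cong (punchIn a) b'≡e' ⟨
      punchIn a b'   ≡⟨ punchIn-punchOut a≢b ⟩
      b              ∎)

module FieldProperties (F : FiniteField) where
  open FiniteField F
  open ≡-Reasoning

  commutativeRing : CommutativeRing 0ℓ 0ℓ
  commutativeRing = record { isCommutativeRing = isCommutativeRing }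

  open CommutativeRing commutativeRing public
    using ( +-assoc; +-comm; +-identityˡ; +-identityʳ; -‿inverseˡ; -‿inverseʳ
          ; *-assoc; *-comm; *-identityˡ; *-identityʳ; zeroˡ; zeroʳ
          ; ring; semiring; commutativeSemiring; +-commutativeMonoid; *-commutativeMonoid
          ; +-commutativeSemigroup)
  open RingProperties ring public
    using ( +-cancelˡ; +-cancelʳ; +-inverseˡ-unique; +-inverseʳ-unique; +-identityʳ-unique
          ; x∙y⁻¹≈ε⇒x≈y; x≈y⇒x∙y⁻¹≈ε; -‿injective; -‿+-comm; -‿distribʳ-*
          ; x[y-z]≈xy-xz; [y-z]x≈yx-zx; //-rightDividesˡ; //-rightDividesʳ; \\-leftDividesʳ)
  open Mult semiring public using (×1-homo-*; ×-assoc-*) renaming (_×_ to _×ₙ_)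
  open Exp semiring using (^-assocʳ) renaming (_^_ to _^ₛ_)
  open CommutativeExp commutativeSemiring using (^-distrib-*)

  inverseˡ : ∀ x → x ≢ 0# → x ⁻¹ * x ≡ 1#
  inverseˡ x x≢0 = trans (*-comm _ _) (inverseʳ x x≢0)

  x⁻¹*[x*y]≡y : ∀ {x} → x ≢ 0# → ∀ y → x ⁻¹ * (x * y) ≡ y
  x⁻¹*[x*y]≡y {x} x≢0 y =
    trans (sym (*-assoc _ x y)) (trans (cong (_* y) (inverseˡ x x≢0)) (*-identityˡ y))

  x*[x⁻¹*y]≡y : ∀ {x} → x ≢ 0# → ∀ y → x * (x ⁻¹ * y) ≡ y
  x*[x⁻¹*y]≡y {x} x≢0 y =
    trans (sym (*-assoc x _ y)) (trans (cong (_* y) (inverseʳ x x≢0)) (*-identityˡ y))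

  *-cancelˡ : ∀ x {y z} → x ≢ 0# → x * y ≡ x * z → y ≡ z
  *-cancelˡ x {y} {z} x≢0 xy≡xz =
    trans (sym (x⁻¹*[x*y]≡y x≢0 y)) (trans (cong (x ⁻¹ *_) xy≡xz) (x⁻¹*[x*y]≡y x≢0 z))

  *-cancelʳ : ∀ x {y z} → x ≢ 0# → y * x ≡ z * x → y ≡ z
  *-cancelʳ x {y} {z} x≢0 yx≡zx = *-cancelˡ x x≢0 (trans (*-comm x y) (trans yx≡zx (*-comm z x)))

  *-≢0 : ∀ {x y} → x ≢ 0# → y ≢ 0# → x * y ≢ 0#
  *-≢0 {x} x≢0 y≢0 xy≡0 = y≢0 (*-cancelˡ x x≢0 (trans xy≡0 (sym (zeroʳ x))))

  x+y≡z+w⇒y-w≡z-x : ∀ {x y z w} → x + y ≡ z + w → y - w ≡ z - x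
  x+y≡z+w⇒y-w≡z-x {x} {y} {z} {w} x+y≡z+w = begin
    y - w                 ≡⟨ cong (_- w) (\\-leftDividesʳ x y) ⟨
    (- x + (x + y)) - w   ≡⟨ cong (λ u → (- x + u) - w) x+y≡z+w ⟩
    (- x + (z + w)) - w   ≡⟨ cong (_- w) (+-assoc (- x) z w) ⟨
    (- x + z + w) - w     ≡⟨ //-rightDividesʳ w (- x + z) ⟩
    - x + z               ≡⟨ +-comm (- x) z ⟩
    z - x                 ∎

  [x-z]-[y-z]≡x-y : ∀ x y z → (x - z) - (y - z) ≡ x - y
  [x-z]-[y-z]≡x-y x y z = x+y≡z+w⇒y-w≡z-x (x∙yz≈y∙xz y x (- z))
    where open CommutativeSemigroupProperties +-commutativeSemigroup using (x∙yz≈y∙xz)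

  ^ᶠ≡^ : ∀ x n → x ^ᶠ n ≡ x ^ₛ n
  ^ᶠ≡^ x zero    = refl
  ^ᶠ≡^ x (suc n) = cong (x *_) (^ᶠ≡^ x n)

  ^ᶠ-distrib-* : ∀ x y n → (x * y) ^ᶠ n ≡ x ^ᶠ n * y ^ᶠ n
  ^ᶠ-distrib-* x y n = begin
    (x * y) ^ᶠ n     ≡⟨ ^ᶠ≡^ (x * y) n ⟩
    (x * y) ^ₛ n     ≡⟨ ^-distrib-* x y n ⟩
    x ^ₛ n * y ^ₛ n  ≡⟨ cong₂ _*_ (^ᶠ≡^ x n) (^ᶠ≡^ y n) ⟨
    x ^ᶠ n * y ^ᶠ n  ∎

  ^ᶠ-assocʳ : ∀ x m n → (x ^ᶠ m) ^ᶠ n ≡ x ^ᶠ (m ℕ.* n)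
  ^ᶠ-assocʳ x m n = begin
    (x ^ᶠ m) ^ᶠ n    ≡⟨ ^ᶠ≡^ (x ^ᶠ m) n ⟩
    (x ^ᶠ m) ^ₛ n    ≡⟨ cong (_^ₛ n) (^ᶠ≡^ x m) ⟩
    (x ^ₛ m) ^ₛ n    ≡⟨ ^-assocʳ x m n ⟩
    x ^ₛ (m ℕ.* n)   ≡⟨ ^ᶠ≡^ x (m ℕ.* n) ⟨
    x ^ᶠ (m ℕ.* n)   ∎

  1^ᶠ : ∀ n → 1# ^ᶠ n ≡ 1#
  1^ᶠ zero    = refl
  1^ᶠ (suc n) = trans (*-identityˡ _) (1^ᶠ n)

  ^ᶠ-≢0 : ∀ {x} n → x ≢ 0# → x ^ᶠ n ≢ 0#
  ^ᶠ-≢0 zero    _   1≡0 = 0≢1 (sym 1≡0)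
  ^ᶠ-≢0 (suc n) x≢0     = *-≢0 x≢0 (^ᶠ-≢0 n x≢0)

  ^ᶠ≡0⇒≡0 : ∀ x n → x ^ᶠ n ≡ 0# → x ≡ 0#
  ^ᶠ≡0⇒≡0 x n xⁿ≡0 with x ≟ 0#
  ... | yes x≡0 = x≡0
  ... | no  x≢0 = ⊥-elim (^ᶠ-≢0 n x≢0 xⁿ≡0)

  ×1-homo-^ : ∀ m n → (m ℕ.^ n) ×ₙ 1# ≡ (m ×ₙ 1#) ^ᶠ n
  ×1-homo-^ m zero    = +-identityʳ 1#
  ×1-homo-^ m (suc n) = trans (×1-homo-* m (m ℕ.^ n)) (cong (m ×ₙ 1# *_) (×1-homo-^ m n))

module Counting (F : FiniteField) where
  open FiniteField F
  open FieldProperties F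
  open ≡-Reasoning

  translation : Carrier → Carrier ↔ Carrier
  translation a = mk↔ₛ′ (_+ a) (_- a) (//-rightDividesˡ a) (//-rightDividesʳ a)

  scaling : ∀ {z} → z ≢ 0# → Carrier ↔ Carrier
  scaling {z} z≢0 = mk↔ₛ′ (z *_) (z ⁻¹ *_) (x*[x⁻¹*y]≡y z≢0) (x⁻¹*[x*y]≡y z≢0)

  module _ {N : ℕ} (e : Fin N ↔ Carrier) where
    open Inverse e using (to; from; strictlyInverseˡ)

    module Summation {c ℓ} (M : CommutativeMonoid c ℓ) where
      open CommutativeMonoid M using (_≈_; reflexive) renaming (Carrier to A; trans to ≈-trans)
      open Sum M using (sum; sum-permute; sum-cong-≗)

      ∑ᶠ : (Carrier → A) → A
      ∑ᶠ f = sum (f ∘ to)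

      ∑ᶠ-reindex : (π : Carrier ↔ Carrier) (f : Carrier → A) → ∑ᶠ f ≈ ∑ᶠ (f ∘ Inverse.to π)
      ∑ᶠ-reindex π f = ≈-trans (sum-permute {N} {N} (f ∘ to) (↔-trans e (↔-trans π (↔-sym e))))
        (reflexive (sum-cong-≗ {N} λ _ → cong f (strictlyInverseˡ _)))

    open Summation +-commutativeMonoid using (∑ᶠ; ∑ᶠ-reindex)
    open Sum +-commutativeMonoid using (∑-distrib-+; sum-replicate)

    N×1≡0 : N ×ₙ 1# ≡ 0#
    N×1≡0 = +-identityʳ-unique S (N ×ₙ 1#) (sym (begin
      S                        ≡⟨ ∑ᶠ-reindex (translation 1#) (λ x → x) ⟩
      ∑ᶠ (_+ 1#)               ≡⟨ ∑-distrib-+ to (λ _ → 1#) ⟩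
      S + ∑ᶠ (λ _ → 1#)        ≡⟨ cong (S +_) (sum-replicate N) ⟩
      S + N ×ₙ 1#              ∎))
      where S = ∑ᶠ (λ x → x)

  ∏-≢0 : ∀ {n} (f : Fin n → Carrier) → (∀ j → f j ≢ 0#) → Sum.sum *-commutativeMonoid f ≢ 0#
  ∏-≢0 {zero}  f f≢0 1≡0 = 0≢1 (sym 1≡0)
  ∏-≢0 {suc n} f f≢0     = *-≢0 (f≢0 zero) (∏-≢0 (f ∘ suc) (f≢0 ∘ suc))

  nonzeroPart : Carrier → Carrier
  nonzeroPart a with a ≟ 0#
  ... | yes _ = 1#
  ... | no  _ = a

  nonzeroPart-0 : nonzeroPart 0# ≡ 1#
  nonzeroPart-0 with 0# ≟ 0#
  ... | yes _   = refl
  ... | no  0≢0 = ⊥-elim (0≢0 refl)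

  nonzeroPart-≢0 : ∀ {a} → a ≢ 0# → nonzeroPart a ≡ a
  nonzeroPart-≢0 {a} a≢0 with a ≟ 0#
  ... | yes a≡0 = ⊥-elim (a≢0 a≡0)
  ... | no  _   = refl

  -- Multiplying by z ≢ 0 permutes the field; nonzeroPart lets the product run over all of it.
  x^N≡x : ∀ {N} (e : Fin N ↔ Carrier) z → z ^ᶠ N ≡ z
  x^N≡x {zero}  e z with () ← Inverse.from e z
  x^N≡x {suc n} e z with z ≟ 0#
  ... | yes refl = zeroˡ _
  ... | no  z≢0  = trans (cong (z *_) zⁿ≡1) (*-identityʳ z)
    where
    open Inverse e using (to; from; strictlyInverseˡ; strictlyInverseʳ)
    open Summation e *-commutativeMonoid renaming (∑ᶠ to ∏ᶠ; ∑ᶠ-reindex to ∏ᶠ-reindex)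
    open Sum *-commutativeMonoid using (sum-remove; sum-cong-≗; ∑-distrib-+; sum-replicate)
      renaming (sum to ∏)

    i₀ = from 0#
    nonzero : Fin n → Carrier
    nonzero j = to (punchIn i₀ j)
    nonzero≢0 : ∀ j → nonzero j ≢ 0#
    nonzero≢0 j eq = punchInᵢ≢i i₀ j (trans (sym (strictlyInverseʳ _)) (cong from eq))
    P = ∏ nonzero

    ∏ᶠ-nonzeroPart-scaled : ∀ {w} → w ≢ 0# → ∏ᶠ (nonzeroPart ∘ (w *_)) ≡ w ^ᶠ n * P
    ∏ᶠ-nonzeroPart-scaled {w} w≢0 = begin
      ∏ᶠ (nonzeroPart ∘ (w *_))
        ≡⟨ sum-remove {i = i₀} (nonzeroPart ∘ (w *_) ∘ to) ⟩
      nonzeroPart (w * to i₀) * ∏ (λ j → nonzeroPart (w * nonzero j))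
        ≡⟨ cong₂ _*_ w·0↦1 (sum-cong-≗ {n} λ j → nonzeroPart-≢0 (*-≢0 w≢0 (nonzero≢0 j))) ⟩
      1# * ∏ (λ j → w * nonzero j)
        ≡⟨ *-identityˡ _ ⟩
      ∏ (λ j → w * nonzero j)
        ≡⟨ ∑-distrib-+ {n} (λ _ → w) nonzero ⟩
      ∏ {n} (λ _ → w) * P
        ≡⟨ cong (_* P) (trans (sum-replicate n) (sym (^ᶠ≡^ w n))) ⟩
      w ^ᶠ n * P ∎
      where
      w·0↦1 : nonzeroPart (w * to i₀) ≡ 1#
      w·0↦1 = trans (cong (nonzeroPart ∘ (w *_)) (strictlyInverseˡ 0#))
                    (trans (cong nonzeroPart (zeroʳ w)) nonzeroPart-0)

    zⁿ≡1 : z ^ᶠ n ≡ 1#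
    zⁿ≡1 = *-cancelʳ P (∏-≢0 nonzero nonzero≢0) (begin
      z ^ᶠ n * P                   ≡⟨ ∏ᶠ-nonzeroPart-scaled z≢0 ⟨
      ∏ᶠ (nonzeroPart ∘ (z *_))    ≡⟨ ∏ᶠ-reindex (scaling z≢0) nonzeroPart ⟨
      ∏ᶠ nonzeroPart               ≡⟨ sum-cong-≗ {suc n} (cong nonzeroPart ∘ *-identityˡ ∘ to) ⟨
      ∏ᶠ (nonzeroPart ∘ (1# *_))   ≡⟨ ∏ᶠ-nonzeroPart-scaled (λ 1≡0 → 0≢1 (sym 1≡0)) ⟩
      1# ^ᶠ n * P                  ≡⟨ cong (_* P) (1^ᶠ n) ⟩
      1# * P                       ∎)

module Frobenius (F : FiniteField) where
  open FiniteField F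
  open FieldProperties F
  open Exp semiring using () renaming (_^_ to _^ₛ_)
  open ≡-Reasoning

  ∣⇒×≡0 : ∀ {p c} → p ×ₙ 1# ≡ 0# → p ∣ c → ∀ w → c ×ₙ w ≡ 0#
  ∣⇒×≡0 {p} p×1≡0 (divides d refl) w = begin
    (d ℕ.* p) ×ₙ w               ≡⟨ cong ((d ℕ.* p) ×ₙ_) (*-identityˡ w) ⟨
    (d ℕ.* p) ×ₙ (1# * w)        ≡⟨ ×-assoc-* (d ℕ.* p) 1# w ⟨
    ((d ℕ.* p) ×ₙ 1#) * w        ≡⟨ cong (_* w) (×1-homo-* d p) ⟩
    (d ×ₙ 1# * p ×ₙ 1#) * w      ≡⟨ cong (λ u → (d ×ₙ 1# * u) * w) p×1≡0 ⟩
    (d ×ₙ 1# * 0#) * w           ≡⟨ cong (_* w) (zeroʳ _) ⟩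
    0# * w                       ≡⟨ zeroˡ w ⟩
    0#                           ∎

  ^p-distrib-+ : ∀ {p} → Prime p → p ×ₙ 1# ≡ 0# → ∀ x y → (x + y) ^ᶠ p ≡ x ^ᶠ p + y ^ᶠ p
  ^p-distrib-+ {zero}  p-prime = ⊥-elim (¬prime[0] p-prime)
  ^p-distrib-+ {suc m} p-prime p×1≡0 x y = begin
    (x + y) ^ᶠ p
      ≡⟨ ^ᶠ≡^ (x + y) p ⟩
    (x + y) ^ₛ p
      ≡⟨ theorem p x y ⟩
    term zero + sum (term ∘ suc)
      ≡⟨ cong (term zero +_) (sum-init-last (term ∘ suc)) ⟩
    term zero + (sum (term ∘ suc ∘ inject₁) + term (suc (fromℕ m)))
      ≡⟨ cong₂ (λ u v → term zero + (u + v)) middle≡0 last≡xᵖ ⟩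
    term zero + (0# + x ^ᶠ p)
      ≡⟨ cong₂ _+_ first≡yᵖ (+-identityˡ _) ⟩
    y ^ᶠ p + x ^ᶠ p
      ≡⟨ +-comm _ _ ⟩
    x ^ᶠ p + y ^ᶠ p
      ∎
    where
    p = suc m
    open Binomial commutativeSemiring using (theorem; binomialTerm)
    open Sum +-commutativeMonoid using (sum; sum-init-last; sum-cong-≗; sum-replicate-zero)
    term = binomialTerm x y p
    first≡yᵖ : term zero ≡ y ^ᶠ p
    first≡yᵖ = trans (+-identityʳ _) (trans (*-identityˡ _) (sym (^ᶠ≡^ y p)))
    last≡xᵖ : term (suc (fromℕ m)) ≡ x ^ᶠ p
    last≡xᵖ rewrite toℕ-fromℕ m | nCn≡1 p | ℕ.n∸n≡0 p =
      trans (+-identityʳ _) (trans (*-identityʳ _) (sym (^ᶠ≡^ x p)))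
    middle≡0 : sum (term ∘ suc ∘ inject₁) ≡ 0#
    middle≡0 = trans (sum-cong-≗ {m} λ k → ∣⇒×≡0 p×1≡0 (prime∣choose p-prime z<s (s<s (inject₁<m k))) _)
                     (sum-replicate-zero m)
      where
      inject₁<m : ∀ k → toℕ (inject₁ k) < m
      inject₁<m k = subst (_< m) (sym (toℕ-inject₁ k)) (toℕ<n k)

  ^pᵉ-distrib-+ : ∀ {p} → Prime p → p ×ₙ 1# ≡ 0# → ∀ e x y →
                  (x + y) ^ᶠ (p ℕ.^ e) ≡ x ^ᶠ (p ℕ.^ e) + y ^ᶠ (p ℕ.^ e)
  ^pᵉ-distrib-+ p-prime p×1≡0 zero x y =
    trans (*-identityʳ _) (sym (cong₂ _+_ (*-identityʳ x) (*-identityʳ y)))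
  ^pᵉ-distrib-+ {p} p-prime p×1≡0 (suc e) x y = begin
    (x + y) ^ᶠ (p ℕ.* pᵉ)                ≡⟨ ^ᶠ-assocʳ (x + y) p pᵉ ⟨
    ((x + y) ^ᶠ p) ^ᶠ pᵉ                 ≡⟨ cong (_^ᶠ pᵉ) (^p-distrib-+ p-prime p×1≡0 x y) ⟩
    (x ^ᶠ p + y ^ᶠ p) ^ᶠ pᵉ              ≡⟨ ^pᵉ-distrib-+ p-prime p×1≡0 e _ _ ⟩
    (x ^ᶠ p) ^ᶠ pᵉ + (y ^ᶠ p) ^ᶠ pᵉ      ≡⟨ cong₂ _+_ (^ᶠ-assocʳ x p pᵉ) (^ᶠ-assocʳ y p pᵉ) ⟩
    x ^ᶠ (p ℕ.* pᵉ) + y ^ᶠ (p ℕ.* pᵉ)    ∎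
    where pᵉ = p ℕ.^ e

^-IsAdditive : FiniteField → ℕ → Set
^-IsAdditive F q = ∀ x y → (x + y) ^ᶠ q ≡ x ^ᶠ q + y ^ᶠ q
  where open FiniteField F

^-IsInvolutive : FiniteField → ℕ → Set
^-IsInvolutive F q = ∀ x → (x ^ᶠ q) ^ᶠ q ≡ x
  where open FiniteField F

module OrderSquareOfPrimePower (p e : ℕ) (p-prime : Prime p) (F : FiniteField)
       (card≡ : FiniteField.card F ≡ (p ^ e) ^ 2) where
  open FiniteField F
  open FieldProperties F
  open Counting F
  open Frobenius F
  open ≡-Reasoning

  q : ℕ
  q = p ^ e

  p×1≡0 : p ×ₙ 1# ≡ 0#
  p×1≡0 = ^ᶠ≡0⇒≡0 _ e (^ᶠ≡0⇒≡0 _ 2 (begin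
    ((p ×ₙ 1#) ^ᶠ e) ^ᶠ 2    ≡⟨ cong (_^ᶠ 2) (×1-homo-^ p e) ⟨
    (q ×ₙ 1#) ^ᶠ 2           ≡⟨ ×1-homo-^ q 2 ⟨
    (q ^ 2) ×ₙ 1#            ≡⟨ cong (_×ₙ 1#) card≡ ⟨
    card ×ₙ 1#               ≡⟨ N×1≡0 enum ⟩
    0#                       ∎))

  ^q-distrib-+ : ^-IsAdditive F q
  ^q-distrib-+ = ^pᵉ-distrib-+ p-prime p×1≡0 e

  ^q-involutive : ^-IsInvolutive F q
  ^q-involutive x = begin
    (x ^ᶠ q) ^ᶠ q     ≡⟨ ^ᶠ-assocʳ x q q ⟩
    x ^ᶠ (q ℕ.* q)    ≡⟨ cong (λ n → x ^ᶠ (q ℕ.* n)) (ℕ.*-identityʳ q) ⟨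
    x ^ᶠ (q ^ 2)      ≡⟨ cong (x ^ᶠ_) card≡ ⟨
    x ^ᶠ card         ≡⟨ x^N≡x enum x ⟩
    x                 ∎

module NearfieldPlane (F : FiniteField) (q : ℕ)
  (^q-distrib-+ : ^-IsAdditive F q) (^q-involutive : ^-IsInvolutive F q) where
  open FiniteField F
  open FieldProperties F
  open Plane F q
  open ≡-Reasoning

  0^q : 0# ^ᶠ q ≡ 0#
  0^q = +-identityʳ-unique (0# ^ᶠ q) (0# ^ᶠ q)
          (trans (sym (^q-distrib-+ 0# 0#)) (cong (_^ᶠ q) (+-identityʳ 0#)))

  -‿^q : ∀ x → (- x) ^ᶠ q ≡ - (x ^ᶠ q)
  -‿^q x = +-inverseˡ-unique ((- x) ^ᶠ q) (x ^ᶠ q)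
             (trans (sym (^q-distrib-+ (- x) x)) (trans (cong (_^ᶠ q) (-‿inverseˡ x)) 0^q))

  [x-y]^q≡x^q-y^q : ∀ x y → (x - y) ^ᶠ q ≡ x ^ᶠ q - y ^ᶠ q
  [x-y]^q≡x^q-y^q x y = trans (^q-distrib-+ x (- y)) (cong (x ^ᶠ q +_) (-‿^q y))

  Tr-distrib-+ : ∀ x y → Tr (x + y) ≡ Tr x + Tr y
  Tr-distrib-+ x y = trans (cong (_+ (x + y)) (^q-distrib-+ x y)) (interchange _ _ _ _)
    where open CommutativeSemigroupProperties +-commutativeSemigroup using (interchange)

  Tr[x-y]≡Trx-Try : ∀ x y → Tr (x - y) ≡ Tr x - Tr y
  Tr[x-y]≡Trx-Try x y = begin
    Tr (x - y)                 ≡⟨ Tr-distrib-+ x (- y) ⟩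
    Tr x + ((- y) ^ᶠ q - y)    ≡⟨ cong (λ u → Tr x + (u - y)) (-‿^q y) ⟩
    Tr x + (- (y ^ᶠ q) - y)    ≡⟨ cong (Tr x +_) (-‿+-comm (y ^ᶠ q) y) ⟩
    Tr x - Tr y                ∎

  Tr-^q : ∀ x → Tr (x ^ᶠ q) ≡ Tr x
  Tr-^q x = trans (cong (_+ x ^ᶠ q) (^q-involutive x)) (+-comm x (x ^ᶠ q))

  ^q-square : ∀ {s} → IsSquare s → IsSquare (s ^ᶠ q)
  ^q-square {s} (w , w*w≡s) = w ^ᶠ q , trans (sym (^ᶠ-distrib-* w w q)) (cong (_^ᶠ q) w*w≡s)

  ⋆-square : ∀ x {s} → IsSquare s → x ⋆ s ≡ x * s
  ⋆-square x {s} s-square with s ≟ 0#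
  ... | yes s≡0 = sym (trans (cong (x *_) s≡0) (zeroʳ x))
  ... | no  _ with isSquare? s
  ...   | yes _         = refl
  ...   | no  ¬s-square = ⊥-elim (¬s-square s-square)

  ⋆-nonsquare : ∀ x {s} → ¬ IsSquare s → x ⋆ s ≡ x ^ᶠ q * s
  ⋆-nonsquare x {s} ¬s-square with s ≟ 0#
  ... | yes s≡0 = ⊥-elim (¬s-square (0# , trans (zeroˡ 0#) (sym s≡0)))
  ... | no  _ with isSquare? s
  ...   | yes s-square = ⊥-elim (¬s-square s-square)
  ...   | no  _        = refl

  σ : Carrier → Carrier
  σ s with isSquare? s
  ... | yes _ = s
  ... | no  _ = s ^ᶠ q

  Tr-⋆ : ∀ x s → Tr (x ⋆ s) ≡ Tr (x * σ s)
  Tr-⋆ x s with isSquare? s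
  ... | yes s-square  = cong Tr (⋆-square x s-square)
  ... | no  ¬s-square = begin
    Tr (x ⋆ s)                      ≡⟨ cong Tr (⋆-nonsquare x ¬s-square) ⟩
    Tr (x ^ᶠ q * s)                 ≡⟨ cong (λ u → Tr (x ^ᶠ q * u)) (^q-involutive s) ⟨
    Tr (x ^ᶠ q * (s ^ᶠ q) ^ᶠ q)     ≡⟨ cong Tr (^ᶠ-distrib-* x (s ^ᶠ q) q) ⟨
    Tr ((x * s ^ᶠ q) ^ᶠ q)          ≡⟨ Tr-^q (x * s ^ᶠ q) ⟩
    Tr (x * s ^ᶠ q)                 ∎

  square≢nonsquare^q : ∀ {s s'} → IsSquare s → ¬ IsSquare s' → s ≢ s' ^ᶠ q
  square≢nonsquare^q {s} {s'} s-square ¬s'-square s≡s'^q =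
    ¬s'-square (subst IsSquare (trans (cong (_^ᶠ q) s≡s'^q) (^q-involutive s')) (^q-square s-square))

  σ-injective : ∀ {s s'} → σ s ≡ σ s' → s ≡ s'
  σ-injective {s} {s'} with isSquare? s | isSquare? s'
  ... | yes _        | yes _          = λ s≡s' → s≡s'
  ... | no  _        | no  _          = λ s^q≡s'^q →
    trans (sym (^q-involutive s)) (trans (cong (_^ᶠ q) s^q≡s'^q) (^q-involutive s'))
  ... | yes s-square  | no  ¬s'-square = ⊥-elim ∘ square≢nonsquare^q s-square ¬s'-square
  ... | no  ¬s-square | yes s'-square  = ⊥-elim ∘ square≢nonsquare^q s'-square ¬s-square ∘ sym

  [u-v]⋆s≡u⋆s-v⋆s : ∀ u v s → (u - v) ⋆ s ≡ u ⋆ s - v ⋆ s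
  [u-v]⋆s≡u⋆s-v⋆s u v s with isSquare? s
  ... | yes s-square = begin
    (u - v) ⋆ s      ≡⟨ ⋆-square (u - v) s-square ⟩
    (u - v) * s      ≡⟨ [y-z]x≈yx-zx s u v ⟩
    u * s - v * s    ≡⟨ cong₂ _-_ (⋆-square u s-square) (⋆-square v s-square) ⟨
    u ⋆ s - v ⋆ s    ∎
  ... | no ¬s-square = begin
    (u - v) ⋆ s                 ≡⟨ ⋆-nonsquare (u - v) ¬s-square ⟩
    (u - v) ^ᶠ q * s            ≡⟨ cong (_* s) ([x-y]^q≡x^q-y^q u v) ⟩
    (u ^ᶠ q - v ^ᶠ q) * s       ≡⟨ [y-z]x≈yx-zx s (u ^ᶠ q) (v ^ᶠ q) ⟩
    u ^ᶠ q * s - v ^ᶠ q * s     ≡⟨ cong₂ _-_ (⋆-nonsquare u ¬s-square) (⋆-nonsquare v ¬s-square) ⟨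
    u ⋆ s - v ⋆ s               ∎

  ⋆-identityʳ : ∀ x → x ⋆ 1# ≡ x
  ⋆-identityʳ x = trans (⋆-square x (1# , *-identityˡ 1#)) (*-identityʳ x)

  ⋆-zeroʳ : ∀ x → x ⋆ 0# ≡ 0#
  ⋆-zeroʳ x = trans (⋆-square x (0# , zeroˡ 0#)) (zeroʳ x)

  ⋆-identityˡ : ∀ t → 1# ⋆ t ≡ t
  ⋆-identityˡ t with isSquare? t
  ... | yes t-square  = trans (⋆-square 1# t-square) (*-identityˡ t)
  ... | no  ¬t-square = trans (⋆-nonsquare 1# ¬t-square) (trans (cong (_* t) (1^ᶠ q)) (*-identityˡ t))

  ⋆-zeroˡ : ∀ t → 0# ⋆ t ≡ 0#
  ⋆-zeroˡ t with isSquare? t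
  ... | yes t-square  = trans (⋆-square 0# t-square) (zeroˡ t)
  ... | no  ¬t-square = trans (⋆-nonsquare 0# ¬t-square) (trans (cong (_* t) 0^q) (zeroˡ t))

  Tr-*-traceless : ∀ r {z} → Tr z ≡ 0# → Tr (r * z) ≡ (r - r ^ᶠ q) * z
  Tr-*-traceless r {z} Tr-z≡0 = begin
    (r * z) ^ᶠ q + r * z        ≡⟨ cong (_+ r * z) (^ᶠ-distrib-* r z q) ⟩
    r ^ᶠ q * z ^ᶠ q + r * z     ≡⟨ cong (λ u → r ^ᶠ q * u + r * z) (+-inverseˡ-unique (z ^ᶠ q) z Tr-z≡0) ⟩
    r ^ᶠ q * - z + r * z        ≡⟨ cong (_+ r * z) (-‿distribʳ-* (r ^ᶠ q) z) ⟨
    - (r ^ᶠ q * z) + r * z      ≡⟨ +-comm _ _ ⟩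
    r * z - r ^ᶠ q * z          ≡⟨ [y-z]x≈yx-zx z r (r ^ᶠ q) ⟨
    (r - r ^ᶠ q) * z            ∎

  InFq⇔Tr-*≡0 : ∀ r {z} → z ≢ 0# → Tr z ≡ 0# → InFq r ⇔ (Tr (r * z) ≡ 0#)
  InFq⇔Tr-*≡0 r {z} z≢0 Tr-z≡0 = mk⇔
    (λ r^q≡r → trans (Tr-*-traceless r Tr-z≡0) (trans (cong (_* z) (x≈y⇒x∙y⁻¹≈ε (sym r^q≡r))) (zeroˡ z)))
    (λ Tr-rz≡0 → sym (x∙y⁻¹≈ε⇒x≈y r (r ^ᶠ q)
       (*-cancelʳ z z≢0 (trans (sym (Tr-*-traceless r Tr-z≡0)) (trans Tr-rz≡0 (sym (zeroˡ z)))))))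

  aff-I-vert : ∀ {a b t} → aff a b I vert t ⇔ (t ≡ - a)
  aff-I-vert {a} {b} {t} = mk⇔
    (λ eq → +-inverseʳ-unique a t (trans (sym normal) eq))
    (λ t≡-a → trans normal (trans (cong (a +_) t≡-a) (-‿inverseʳ a)))
    where
    normal : a ⋆ 1# + b ⋆ 0# + 1# ⋆ t ≡ a + t
    normal = cong₂ _+_ (trans (cong₂ _+_ (⋆-identityʳ a) (⋆-zeroʳ b)) (+-identityʳ a)) (⋆-identityˡ t)

  aff-I-nonvert : ∀ {a b s t} → aff a b I nonvert s t → a ⋆ s + b ≡ - t
  aff-I-nonvert {a} {b} {s} {t} eq = +-inverseˡ-unique (a ⋆ s + b) t
    (trans (sym (cong₂ (λ u v → a ⋆ s + u + v) (⋆-identityʳ b) (⋆-identityˡ t))) eq)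

  aff∉linf : ∀ {a b} → ¬ aff a b I linf
  aff∉linf {a} {b} eq = 0≢1 (begin
    0#                              ≡⟨ eq ⟨
    a ⋆ 0# + b ⋆ 0# + 1# ⋆ 1#       ≡⟨ cong₂ (λ u v → u + v + 1# ⋆ 1#) (⋆-zeroʳ a) (⋆-zeroʳ b) ⟩
    0# + 0# + 1# ⋆ 1#               ≡⟨ cong₂ _+_ (+-identityʳ 0#) (⋆-identityʳ 1#) ⟩
    0# + 1#                         ≡⟨ +-identityˡ 1# ⟩
    1#                              ∎)

  vinf∉nonvert : ∀ {s t} → ¬ vinf I nonvert s t
  vinf∉nonvert {s} {t} eq = 0≢1 (begin
    0#                              ≡⟨ eq ⟨
    0# ⋆ s + 1# ⋆ 1# + 0# ⋆ t       ≡⟨ cong₂ (λ u v → u + 1# ⋆ 1# + v) (⋆-zeroˡ s) (⋆-zeroˡ t) ⟩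
    0# + 1# ⋆ 1# + 0#               ≡⟨ +-identityʳ _ ⟩
    0# + 1# ⋆ 1#                    ≡⟨ trans (+-identityˡ _) (⋆-identityʳ 1#) ⟩
    1#                              ∎)

  _I?_ : ∀ P ℓ → Dec (P I ℓ)
  P I? ℓ with ptCoords P | lnCoords ℓ
  ... | ⟨ a , b , c ⟩ | ⟨ s , u , t ⟩ = (a ⋆ s + b ⋆ u + c ⋆ t) ≟ 0#

  IsVertical : Line → Set
  IsVertical ℓ = ∃ λ t → ℓ ≡ vert t

  vertical-through-vinf : ∀ {ℓ} → vinf I ℓ → ℓ ≢ linf → IsVertical ℓ
  vertical-through-vinf {nonvert s t} V∈ℓ _   = ⊥-elim (vinf∉nonvert V∈ℓ)
  vertical-through-vinf {vert t}      _   _   = t , refl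
  vertical-through-vinf {linf}        _   ℓ≢∞ = ⊥-elim (ℓ≢∞ refl)

  vertical-through-same-x : ∀ {a b b' ℓ} → b ≢ b' → aff a b I ℓ → aff a b' I ℓ → IsVertical ℓ
  vertical-through-same-x {ℓ = nonvert s t} b≢b' P∈ℓ P'∈ℓ =
    ⊥-elim (b≢b' (+-cancelˡ _ _ _ (trans (aff-I-nonvert P∈ℓ) (sym (aff-I-nonvert P'∈ℓ)))))
  vertical-through-same-x {ℓ = vert t}      _    _   _    = t , refl
  vertical-through-same-x {ℓ = linf}        _    P∈ℓ _    = ⊥-elim (aff∉linf P∈ℓ)

  nonvertical-through-distinct-x : ∀ {a b a' b' ℓ} → aff a b I ℓ → aff a' b' I ℓ → a ≢ a' →
                                  ∃ λ s → ∃ λ t → ℓ ≡ nonvert s t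
  nonvertical-through-distinct-x {ℓ = nonvert s t} _   _    _     = s , t , refl
  nonvertical-through-distinct-x {ℓ = vert t}      P∈ℓ P'∈ℓ a≢a' =
    ⊥-elim (a≢a' (-‿injective (trans (sym (Equivalence.to aff-I-vert P∈ℓ))
                                      (Equivalence.to aff-I-vert P'∈ℓ))))
  nonvertical-through-distinct-x {ℓ = linf}        P∈ℓ _    _     = ⊥-elim (aff∉linf P∈ℓ)

  nonvert-slope : ∀ {x y x' y' s t} → aff x y I nonvert s t → aff x' y' I nonvert s t →
                  y' - y ≡ (x - x') ⋆ s
  nonvert-slope {x} {y} {x'} {y'} {s} P∈ℓ P'∈ℓ = begin
    y' - y             ≡⟨ x+y≡z+w⇒y-w≡z-x (trans (aff-I-nonvert P'∈ℓ) (sym (aff-I-nonvert P∈ℓ))) ⟩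
    x ⋆ s - x' ⋆ s     ≡⟨ [u-v]⋆s≡u⋆s-v⋆s x x' s ⟨
    (x - x') ⋆ s       ∎

  Tr-difference : ∀ {x y x₁ y₁ y₁' s t s' t'} →
    aff x y I nonvert s t → aff x₁ y₁ I nonvert s t →
    aff x y I nonvert s' t' → aff x₁ y₁' I nonvert s' t' →
    Tr y₁ - Tr y₁' ≡ Tr ((x - x₁) * (σ s - σ s'))
  Tr-difference {x} {y} {x₁} {y₁} {y₁'} {s} {t} {s'} {t'} P∈ℓ P₁∈ℓ P∈ℓ' P₁'∈ℓ' = begin
    Tr y₁ - Tr y₁'                          ≡⟨ [x-z]-[y-z]≡x-y (Tr y₁) (Tr y₁') (Tr y) ⟨
    (Tr y₁ - Tr y) - (Tr y₁' - Tr y)        ≡⟨ cong₂ _-_ (Tr[x-y]≡Trx-Try y₁ y) (Tr[x-y]≡Trx-Try y₁' y) ⟨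
    Tr (y₁ - y) - Tr (y₁' - y)              ≡⟨ cong₂ (λ u v → Tr u - Tr v) (nonvert-slope P∈ℓ P₁∈ℓ)
                                                                             (nonvert-slope P∈ℓ' P₁'∈ℓ') ⟩
    Tr (d ⋆ s) - Tr (d ⋆ s')                ≡⟨ cong₂ _-_ (Tr-⋆ d s) (Tr-⋆ d s') ⟩
    Tr (d * σ s) - Tr (d * σ s')            ≡⟨ Tr[x-y]≡Trx-Try (d * σ s) (d * σ s') ⟨
    Tr (d * σ s - d * σ s')                 ≡⟨ cong Tr (x[y-z]≈xy-xz d (σ s) (σ s')) ⟨
    Tr (d * (σ s - σ s'))                   ∎
    where d = x - x₁

  ratio∈Fq⇔Tr≡Tr-nonvert : ∀ {x y x₁ y₁ y₁' x₂ y₂ y₂' s t s' t'} →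
    aff x y I nonvert s t → aff x₁ y₁ I nonvert s t → aff x₂ y₂ I nonvert s t →
    aff x y I nonvert s' t' → aff x₁ y₁' I nonvert s' t' → aff x₂ y₂' I nonvert s' t' →
    x ≢ x₁ → y₁ ≢ y₁' → Tr y₁ ≡ Tr y₁' →
    InFq ((x - x₂) * ((x - x₁) ⁻¹)) ⇔ (Tr y₂ ≡ Tr y₂')
  ratio∈Fq⇔Tr≡Tr-nonvert {x} {y} {x₁} {y₁} {y₁'} {x₂} {y₂} {y₂'} {s} {t} {s'} {t'}
                 P∈ℓ P₁∈ℓ P₂∈ℓ P∈ℓ' P₁'∈ℓ' P₂'∈ℓ' x≢x₁ y₁≢y₁' Tr-y₁≡Tr-y₁' = mk⇔
    (λ r∈Fq → x∙y⁻¹≈ε⇒x≈y _ _ (trans (Tr-difference P∈ℓ P₂∈ℓ P∈ℓ' P₂'∈ℓ')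
                 (trans (cong Tr (sym rz≡d₂c)) (Equivalence.to r∈Fq⇔Tr-rz≡0 r∈Fq))))
    (λ Tr-y₂≡Tr-y₂' → Equivalence.from r∈Fq⇔Tr-rz≡0 (trans (cong Tr rz≡d₂c)
                 (trans (sym (Tr-difference P∈ℓ P₂∈ℓ P∈ℓ' P₂'∈ℓ')) (x≈y⇒x∙y⁻¹≈ε Tr-y₂≡Tr-y₂'))))
    where
    d₁ = x - x₁
    d₂ = x - x₂
    c = σ s - σ s'
    r = d₂ * d₁ ⁻¹

    d₁≢0 : d₁ ≢ 0#
    d₁≢0 d₁≡0 = x≢x₁ (x∙y⁻¹≈ε⇒x≈y x x₁ d₁≡0)

    c≢0 : c ≢ 0#
    c≢0 c≡0 = y₁≢y₁' (+-cancelʳ (- y) y₁ y₁' (begin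
      y₁ - y      ≡⟨ nonvert-slope P∈ℓ P₁∈ℓ ⟩
      d₁ ⋆ s      ≡⟨ cong (d₁ ⋆_) (σ-injective (x∙y⁻¹≈ε⇒x≈y (σ s) (σ s') c≡0)) ⟩
      d₁ ⋆ s'     ≡⟨ nonvert-slope P∈ℓ' P₁'∈ℓ' ⟨
      y₁' - y     ∎))

    Tr-d₁c≡0 : Tr (d₁ * c) ≡ 0#
    Tr-d₁c≡0 = trans (sym (Tr-difference P∈ℓ P₁∈ℓ P∈ℓ' P₁'∈ℓ')) (x≈y⇒x∙y⁻¹≈ε Tr-y₁≡Tr-y₁')

    rz≡d₂c : r * (d₁ * c) ≡ d₂ * c
    rz≡d₂c = trans (*-assoc d₂ (d₁ ⁻¹) (d₁ * c)) (cong (d₂ *_) (x⁻¹*[x*y]≡y d₁≢0 c))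

    r∈Fq⇔Tr-rz≡0 : InFq r ⇔ (Tr (r * (d₁ * c)) ≡ 0#)
    r∈Fq⇔Tr-rz≡0 = InFq⇔Tr-*≡0 r (*-≢0 d₁≢0 c≢0) Tr-d₁c≡0

  ratio∈Fq⇔Tr≡Tr : ∀ {x y x₁ y₁ y₁' x₂ y₂ y₂' ℓ ℓ'} →
    aff x y I ℓ → aff x₁ y₁ I ℓ → aff x₂ y₂ I ℓ →
    aff x y I ℓ' → aff x₁ y₁' I ℓ' → aff x₂ y₂' I ℓ' →
    x ≢ x₁ → y₁ ≢ y₁' → Tr y₁ ≡ Tr y₁' →
    InFq ((x - x₂) * ((x - x₁) ⁻¹)) ⇔ (Tr y₂ ≡ Tr y₂')
  ratio∈Fq⇔Tr≡Tr {ℓ = ℓ} {ℓ'} P∈ℓ P₁∈ℓ P₂∈ℓ P∈ℓ' P₁'∈ℓ' P₂'∈ℓ' x≢x₁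
    with nonvertical-through-distinct-x {ℓ = ℓ} P∈ℓ P₁∈ℓ x≢x₁
       | nonvertical-through-distinct-x {ℓ = ℓ'} P∈ℓ' P₁'∈ℓ' x≢x₁
  ... | _ , _ , refl | _ , _ , refl = ratio∈Fq⇔Tr≡Tr-nonvert P∈ℓ P₁∈ℓ P₂∈ℓ P∈ℓ' P₁'∈ℓ' P₂'∈ℓ' x≢x₁

  module Configuration (x y x₁ x₂ y₁₁ y₁₂ y₂₁ y₂₂ : Carrier)
    (onan : ONan (sixPoints x y x₁ x₂ y₁₁ y₁₂ y₂₁ y₂₂)) where

    pts : Fin 6 → Point
    pts = sixPoints x y x₁ x₂ y₁₁ y₁₂ y₂₁ y₂₂

    pts-injective : ∀ i j → pts i ≡ pts j → i ≡ j
    pts-injective = proj₁ onan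

    L : Fin 4 → Line
    L = proj₁ (proj₂ onan)

    L-injective : ∀ a b → L a ≡ L b → a ≡ b
    L-injective = proj₁ (proj₂ (proj₂ onan))

    meet : ∀ a b → a ≢ b → ∃ λ k → (pts k I L a) × (pts k I L b)
    meet = proj₁ (proj₂ (proj₂ (proj₂ onan)))

    two-lines : ∀ k → ∃ λ a → ∃ λ b → a ≢ b × (pts k I L a) × (pts k I L b)
    two-lines = proj₂ (proj₂ (proj₂ (proj₂ onan)))

    -- Fin 5 indexes the affine points P, P₁₁, P₁₂, P₂₁, P₂₂, which are pts 1, …, pts 5.
    X Y : Fin 5 → Carrier
    X 0F = x
    X 1F = x₁
    X 2F = x₁
    X 3F = x₂
    X 4F = x₂
    Y 0F = y
    Y 1F = y₁₁
    Y 2F = y₁₂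
    Y 3F = y₂₁
    Y 4F = y₂₂

    pts-suc : ∀ j → pts (suc j) ≡ aff (X j) (Y j)
    pts-suc 0F = refl
    pts-suc 1F = refl
    pts-suc 2F = refl
    pts-suc 3F = refl
    pts-suc 4F = refl

    On : Fin 5 → Fin 4 → Set
    On j a = aff (X j) (Y j) I L a

    two-lines-aff : ∀ j → ∃ λ a → ∃ λ b → a ≢ b × On j a × On j b
    two-lines-aff j with two-lines (suc j)
    ... | a , b , a≢b , j∈a , j∈b =
      a , b , a≢b , subst (_I L a) (pts-suc j) j∈a , subst (_I L b) (pts-suc j) j∈b

    Y-distinct : ∀ {j j'} → j ≢ j' → X j ≡ X j' → Y j ≢ Y j'
    Y-distinct {j} {j'} j≢j' Xj≡Xj' Yj≡Yj' = j≢j' (suc-injective (pts-injective (suc j) (suc j') (begin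
      pts (suc j)         ≡⟨ pts-suc j ⟩
      aff (X j) (Y j)     ≡⟨ cong₂ aff Xj≡Xj' Yj≡Yj' ⟩
      aff (X j') (Y j')   ≡⟨ pts-suc j' ⟨
      pts (suc j')        ∎)))

    On-vertical : ∀ {j a t} → L a ≡ vert t → On j a → t ≡ - X j
    On-vertical {j} La≡vert j∈a = Equivalence.to aff-I-vert (subst (aff (X j) (Y j) I_) La≡vert j∈a)

    same-x-on-vertical : ∀ {j j' a} → X j ≡ X j' → IsVertical (L a) → On j a → On j' a
    same-x-on-vertical {j} {j'} Xj≡Xj' (t , La≡vert) j∈a = subst (aff (X j') (Y j') I_) (sym La≡vert)
      (Equivalence.from aff-I-vert (trans (On-vertical La≡vert j∈a) (cong -_ Xj≡Xj')))

    vertical⇒same-x : ∀ {j j' a} → IsVertical (L a) → On j a → On j' a → X j ≡ X j'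
    vertical⇒same-x (t , La≡vert) j∈a j'∈a =
      -‿injective (trans (sym (On-vertical La≡vert j∈a)) (On-vertical La≡vert j'∈a))

    one-vertical-per-point : ∀ {j a e} → IsVertical (L a) → IsVertical (L e) → On j a → On j e → a ≡ e
    one-vertical-per-point {a = a} {e} (t , La≡vert) (t' , Le≡vert) j∈a j∈e = L-injective a e (begin
      L a       ≡⟨ La≡vert ⟩
      vert t    ≡⟨ cong vert (trans (On-vertical La≡vert j∈a) (sym (On-vertical Le≡vert j∈e))) ⟩
      vert t'   ≡⟨ Le≡vert ⟨
      L e       ∎)

    vertical-through-pair : ∀ {j j' a} → j ≢ j' → X j ≡ X j' → On j a → On j' a → IsVertical (L a)
    vertical-through-pair {j} {j'} {a} j≢j' Xj≡Xj' j∈a j'∈a = vertical-through-same-x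
      (Y-distinct j≢j' Xj≡Xj') j∈a (subst (λ u → aff u (Y j') I L a) (sym Xj≡Xj') j'∈a)

    same-x-one-common-line : ∀ {j j' a e} → j ≢ j' → X j ≡ X j' →
                             On j a → On j' a → On j e → On j' e → a ≡ e
    same-x-one-common-line j≢j' Xj≡Xj' j∈a j'∈a j∈e j'∈e = one-vertical-per-point
      (vertical-through-pair j≢j' Xj≡Xj' j∈a j'∈a) (vertical-through-pair j≢j' Xj≡Xj' j∈e j'∈e) j∈a j∈e

    vertical-pair-no-other-common-line : ∀ {j j' a e} → IsVertical (L a) → j ≢ j' →
      On j a → On j' a → e ≢ a → On j e → On j' e → ⊥
    vertical-pair-no-other-common-line a-vertical j≢j' j∈a j'∈a e≢a j∈e j'∈e = e≢a (sym
      (same-x-one-common-line j≢j' (vertical⇒same-x a-vertical j∈a j'∈a) j∈a j'∈a j∈e j'∈e))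

    another-line : ∀ j a → ∃ λ w → w ≢ a × On j w
    another-line j a with two-lines-aff j
    ... | u , v , u≢v , j∈u , j∈v with u Fin.≟ a
    ...   | yes u≡a = v , (λ v≡a → u≢v (trans u≡a (sym v≡a))) , j∈v
    ...   | no  u≢a = u , u≢a , j∈u

    no-line-at-infinity : ∀ e → L e ≢ linf
    no-line-at-infinity e Le≡∞ with two-lines-aff 0F
    ... | u , v , u≢v , P∈u , P∈v =
      u≢v (one-vertical-per-point (vertical-via-V P∈u) (vertical-via-V P∈v) P∈u P∈v)
      where
      -- L e meets every line through P, and only V can lie on L e.
      vertical-via-V : ∀ {w} → On 0F w → IsVertical (L w)
      vertical-via-V {w} P∈w with meet e w (λ { refl → aff∉linf (subst (aff x y I_) Le≡∞ P∈w) })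
      ... | zero  , _   , V∈w = vertical-through-vinf V∈w (λ Lw≡∞ → aff∉linf (subst (aff x y I_) Lw≡∞ P∈w))
      ... | suc j , j∈e , _   = ⊥-elim (aff∉linf (subst (_I linf) (pts-suc j) (subst (pts (suc j) I_) Le≡∞ j∈e)))

    vertical-through-V : ∀ {e} → vinf I L e → IsVertical (L e)
    vertical-through-V {e} V∈e = vertical-through-vinf V∈e (no-line-at-infinity e)

    Conclusion : Set
    Conclusion = InFq ((x - x₂) * ((x - x₁) ⁻¹)) ⇔ (Tr y₂₁ ≡ Tr y₂₂)

    -- A and B are the two lines of the configuration through V = (0,1,0); C and D are the other two.
    module Frame {A B : Fin 4} (A≢B : A ≢ B) (A-vertical : IsVertical (L A)) (B-vertical : IsVertical (L B))
      where
      C D : Fin 4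
      C = others A≢B 0F
      D = others A≢B 1F

      C≢D : C ≢ D
      C≢D C≡D with () ← others-injective A≢B C≡D

      C-or-D : ∀ e → e ≢ A → e ≢ B → e ≡ C ⊎ e ≡ D
      C-or-D e e≢A e≢B with others-surjective A≢B e e≢A e≢B
      ... | 0F , e≡C = inj₁ e≡C
      ... | 1F , e≡D = inj₂ e≡D

      second-line : ∀ {j a} → IsVertical (L a) → On j a → (C ≢ a × On j C) ⊎ (D ≢ a × On j D)
      second-line {j} {a} a-vertical j∈a with another-line j a
      ... | w , w≢a , j∈w with C-or-D w (avoid A-vertical) (avoid B-vertical)
        where
        avoid : ∀ {e} → IsVertical (L e) → w ≢ e
        avoid e-vertical refl = w≢a (one-vertical-per-point e-vertical a-vertical j∈w j∈a)
      ... | inj₁ refl = inj₁ (w≢a , j∈w)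
      ... | inj₂ refl = inj₂ (w≢a , j∈w)

      off-A-B⇒on-C-D : ∀ {j} → ¬ On j A → ¬ On j B → On j C × On j D
      off-A-B⇒on-C-D {j} j∉A j∉B with two-lines-aff j
      ... | u , v , u≢v , j∈u , j∈v
        with C-or-D u (avoidA j∈u) (avoidB j∈u) | C-or-D v (avoidA j∈v) (avoidB j∈v)
        where
        avoidA : ∀ {e} → On j e → e ≢ A
        avoidA j∈e refl = j∉A j∈e
        avoidB : ∀ {e} → On j e → e ≢ B
        avoidB j∈e refl = j∉B j∈e
      ... | inj₁ refl | inj₁ refl = ⊥-elim (u≢v refl)
      ... | inj₁ refl | inj₂ refl = j∈u , j∈v
      ... | inj₂ refl | inj₁ refl = j∈v , j∈u
      ... | inj₂ refl | inj₂ refl = ⊥-elim (u≢v refl)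

      pair-splits : ∀ {j j' a} → IsVertical (L a) → j ≢ j' → On j a → On j' a →
                    (On j C × On j' D) ⊎ (On j D × On j' C)
      pair-splits {j} {j'} {a} a-vertical j≢j' j∈a j'∈a
        with second-line a-vertical j∈a | second-line a-vertical j'∈a
      ... | inj₁ (C≢a , j∈C) | inj₁ (_ , j'∈C) = ⊥-elim (clash C≢a j∈C j'∈C)
        where clash = vertical-pair-no-other-common-line a-vertical j≢j' j∈a j'∈a
      ... | inj₁ (_   , j∈C) | inj₂ (_ , j'∈D) = inj₁ (j∈C , j'∈D)
      ... | inj₂ (_   , j∈D) | inj₁ (_ , j'∈C) = inj₂ (j∈D , j'∈C)
      ... | inj₂ (D≢a , j∈D) | inj₂ (_ , j'∈D) = ⊥-elim (clash D≢a j∈D j'∈D)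
        where clash = vertical-pair-no-other-common-line a-vertical j≢j' j∈a j'∈a

      no-three-on-vertical : ∀ {j₁ j₂ j₃ a} → IsVertical (L a) → j₁ ≢ j₂ → j₁ ≢ j₃ → j₂ ≢ j₃ →
                             On j₁ a → On j₂ a → On j₃ a → ⊥
      no-three-on-vertical {j₁} {j₂} {j₃} {a} a-vertical j₁≢j₂ j₁≢j₃ j₂≢j₃ j₁∈a j₂∈a j₃∈a =
        pigeonhole (second-line a-vertical j₁∈a) (second-line a-vertical j₂∈a) (second-line a-vertical j₃∈a)
        where
        clash : ∀ {j j' e} → j ≢ j' → On j a → On j' a → e ≢ a → On j e → On j' e → ⊥
        clash = vertical-pair-no-other-common-line a-vertical
        Side : Fin 5 → Set
        Side j = (C ≢ a × On j C) ⊎ (D ≢ a × On j D)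
        pigeonhole : Side j₁ → Side j₂ → Side j₃ → ⊥
        pigeonhole (inj₁ (e≢a , j₁∈e)) (inj₁ (_ , j₂∈e)) _ = clash j₁≢j₂ j₁∈a j₂∈a e≢a j₁∈e j₂∈e
        pigeonhole (inj₂ (e≢a , j₁∈e)) (inj₂ (_ , j₂∈e)) _ = clash j₁≢j₂ j₁∈a j₂∈a e≢a j₁∈e j₂∈e
        pigeonhole (inj₁ (e≢a , j₁∈e)) (inj₂ _) (inj₁ (_ , j₃∈e)) = clash j₁≢j₃ j₁∈a j₃∈a e≢a j₁∈e j₃∈e
        pigeonhole (inj₂ (e≢a , j₁∈e)) (inj₁ _) (inj₂ (_ , j₃∈e)) = clash j₁≢j₃ j₁∈a j₃∈a e≢a j₁∈e j₃∈e
        pigeonhole (inj₁ _) (inj₂ (e≢a , j₂∈e)) (inj₂ (_ , j₃∈e)) = clash j₂≢j₃ j₂∈a j₃∈a e≢a j₂∈e j₃∈e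
        pigeonhole (inj₂ _) (inj₁ (e≢a , j₂∈e)) (inj₁ (_ , j₃∈e)) = clash j₂≢j₃ j₂∈a j₃∈a e≢a j₂∈e j₃∈e

      same-x-pair-on-A-or-B : ∀ {j j'} → j ≢ j' → X j ≡ X j' → (On j A × On j' A) ⊎ (On j B × On j' B)
      same-x-pair-on-A-or-B {j} {j'} j≢j' Xj≡Xj' with aff (X j) (Y j) I? L A | aff (X j) (Y j) I? L B
      ... | yes j∈A | _       = inj₁ (j∈A , same-x-on-vertical Xj≡Xj' A-vertical j∈A)
      ... | no  _   | yes j∈B = inj₂ (j∈B , same-x-on-vertical Xj≡Xj' B-vertical j∈B)
      ... | no  j∉A | no  j∉B = ⊥-elim (C≢D (same-x-one-common-line j≢j' Xj≡Xj' j∈C j'∈C j∈D j'∈D))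
        where
        j∈C×D = off-A-B⇒on-C-D j∉A j∉B
        j∈C = proj₁ j∈C×D
        j∈D = proj₂ j∈C×D
        j'∈C×D = off-A-B⇒on-C-D (j∉A ∘ same-x-on-vertical (sym Xj≡Xj') A-vertical)
                                 (j∉B ∘ same-x-on-vertical (sym Xj≡Xj') B-vertical)
        j'∈C = proj₁ j'∈C×D
        j'∈D = proj₂ j'∈C×D

      pairs-on-A-and-B⇒conclusion : On 1F A → On 2F A → On 3F B → On 4F B → Tr y₁₁ ≡ Tr y₁₂ → Conclusion
      pairs-on-A-and-B⇒conclusion P₁₁∈A P₁₂∈A P₂₁∈B P₂₂∈B Tr-y₁₁≡Tr-y₁₂ =
        by-splits (pair-splits A-vertical (λ ()) P₁₁∈A P₁₂∈A) (pair-splits B-vertical (λ ()) P₂₁∈B P₂₂∈B)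
        where
        P∉A : ¬ On 0F A
        P∉A P∈A = no-three-on-vertical A-vertical (λ ()) (λ ()) (λ ()) P∈A P₁₁∈A P₁₂∈A
        P∉B : ¬ On 0F B
        P∉B P∈B = no-three-on-vertical B-vertical (λ ()) (λ ()) (λ ()) P∈B P₂₁∈B P₂₂∈B
        P∈C = proj₁ (off-A-B⇒on-C-D P∉A P∉B)
        P∈D = proj₂ (off-A-B⇒on-C-D P∉A P∉B)
        x≢x₁ : x ≢ x₁
        x≢x₁ x≡x₁ = P∉A (same-x-on-vertical {1F} {0F} (sym x≡x₁) A-vertical P₁₁∈A)

        through-P₁₁-and-P₁₂ : ∀ e e' {y₂ y₂'} → On 0F e → On 1F e → aff x₂ y₂ I L e →
          On 0F e' → On 2F e' → aff x₂ y₂' I L e' → InFq ((x - x₂) * ((x - x₁) ⁻¹)) ⇔ (Tr y₂ ≡ Tr y₂')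
        through-P₁₁-and-P₁₂ e e' P∈e P₁∈e P₂∈e P∈e' P₁'∈e' P₂'∈e' = ratio∈Fq⇔Tr≡Tr {ℓ = L e} {L e'}
          P∈e P₁∈e P₂∈e P∈e' P₁'∈e' P₂'∈e' x≢x₁ (Y-distinct {1F} {2F} (λ ()) refl) Tr-y₁₁≡Tr-y₁₂

        flip : InFq ((x - x₂) * ((x - x₁) ⁻¹)) ⇔ (Tr y₂₂ ≡ Tr y₂₁) → Conclusion
        flip h = ⇔-trans h (mk⇔ sym sym)

        by-splits : (On 1F C × On 2F D) ⊎ (On 1F D × On 2F C) →
                    (On 3F C × On 4F D) ⊎ (On 3F D × On 4F C) → Conclusion
        by-splits (inj₁ (P₁₁∈C , P₁₂∈D)) (inj₁ (P₂₁∈C , P₂₂∈D)) =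
          through-P₁₁-and-P₁₂ C D P∈C P₁₁∈C P₂₁∈C P∈D P₁₂∈D P₂₂∈D
        by-splits (inj₁ (P₁₁∈C , P₁₂∈D)) (inj₂ (P₂₁∈D , P₂₂∈C)) =
          flip (through-P₁₁-and-P₁₂ C D P∈C P₁₁∈C P₂₂∈C P∈D P₁₂∈D P₂₁∈D)
        by-splits (inj₂ (P₁₁∈D , P₁₂∈C)) (inj₁ (P₂₁∈C , P₂₂∈D)) =
          flip (through-P₁₁-and-P₁₂ D C P∈D P₁₁∈D P₂₂∈D P∈C P₁₂∈C P₂₁∈C)
        by-splits (inj₂ (P₁₁∈D , P₁₂∈C)) (inj₂ (P₂₁∈D , P₂₂∈C)) =
          through-P₁₁-and-P₁₂ D C P∈D P₁₁∈D P₂₁∈D P∈C P₁₂∈C P₂₂∈C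

    verticals-through-V⇒conclusion : ∀ {A B} → A ≢ B → IsVertical (L A) → IsVertical (L B) →
                                     Tr y₁₁ ≡ Tr y₁₂ → Conclusion
    verticals-through-V⇒conclusion A≢B A-vertical B-vertical
      with AB.same-x-pair-on-A-or-B {1F} {2F} (λ ()) refl | AB.same-x-pair-on-A-or-B {3F} {4F} (λ ()) refl
      where module AB = Frame A≢B A-vertical B-vertical
    ... | inj₁ (P₁₁∈A , P₁₂∈A) | inj₁ (P₂₁∈A , _) = ⊥-elim
      (Frame.no-three-on-vertical A≢B A-vertical B-vertical A-vertical (λ ()) (λ ()) (λ ()) P₁₁∈A P₁₂∈A P₂₁∈A)
    ... | inj₂ (P₁₁∈B , P₁₂∈B) | inj₂ (P₂₁∈B , _) = ⊥-elim
      (Frame.no-three-on-vertical A≢B A-vertical B-vertical B-vertical (λ ()) (λ ()) (λ ()) P₁₁∈B P₁₂∈B P₂₁∈B)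
    ... | inj₁ (P₁₁∈A , P₁₂∈A) | inj₂ (P₂₁∈B , P₂₂∈B) =
      Frame.pairs-on-A-and-B⇒conclusion A≢B A-vertical B-vertical P₁₁∈A P₁₂∈A P₂₁∈B P₂₂∈B
    ... | inj₂ (P₁₁∈B , P₁₂∈B) | inj₁ (P₂₁∈A , P₂₂∈A) =
      Frame.pairs-on-A-and-B⇒conclusion (A≢B ∘ sym) B-vertical A-vertical P₁₁∈B P₁₂∈B P₂₁∈A P₂₂∈A

    theorem : Tr y₁₁ ≡ Tr y₁₂ → Conclusion
    theorem with two-lines 0F
    ... | A , B , A≢B , V∈A , V∈B =
      verticals-through-V⇒conclusion A≢B (vertical-through-V V∈A) (vertical-through-V V∈B)

lemma6p3 : (p e : ℕ) → Prime p → p ≢ 2 → 1 ≤ e →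
    (F : FiniteField) → FiniteField.card F ≡ (p ^ e) ^ 2 →
    let open FiniteField F in let open Plane F (p ^ e) in (x y x₁ x₂ y₁₁ y₁₂ y₂₁ y₂₂ : Carrier) →
       y ≢ y₁₁ → y ≢ y₁₂ → y ≢ y₂₁ → y ≢ y₂₂ →
       ONan (sixPoints x y x₁ x₂ y₁₁ y₁₂ y₂₁ y₂₂) →
       Tr y₁₁ ≡ Tr y₁₂ →
       (InFq ((x - x₂) * ((x - x₁) ⁻¹)) ⇔ (Tr y₂₁ ≡ Tr y₂₂))
lemma6p3 p e p-prime _ _ F card≡ x y x₁ x₂ y₁₁ y₁₂ y₂₁ y₂₂ _ _ _ _ onan =
  Configuration.theorem x y x₁ x₂ y₁₁ y₁₂ y₂₁ y₂₂ onan
  where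
  open OrderSquareOfPrimePower p e p-prime F card≡
  open NearfieldPlane F q ^q-distrib-+ ^q-involutive
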